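{- There is a parameterized vector game $\mathcal{G}=(A,B,\mathcal{F})$ such that $\mathrm{Win}(\mathcal{G})$ does not have a cutoff with respect to $(\{0\},\{0\},\mathbb{N})$.
   Context: $\mathbb{T}=\{s,e,se\}$. A parameterized vector game is $\mathcal{G}=(A,B,\mathcal{F})$ with $A=A_s\uplus A_e$ finite, $B\in\mathbb{N}$, locations $L=\{0,\dots,B\}^A$, and a finite set $\mathcal{F}\subseteq\mathfrak{C}^L$, where $\mathfrak{C}$ is the set of local acceptance conditions $(\bowtie_s n_s,\bowtie_e n_e,\bowtie_{se}n_{se})$ with $\bowtie_\theta\in\{=,\ge\}$, $n_\theta\in\mathbb{N}$. $\ell_0$ is the all-zero location; $(\ell+a)(a)=\min\{\ell(a)+1,B\}$, $(\ell+a)(b)=\ell(b)$ for $b\ne a$, extended to words. A configuration is $C:L\to\mathbb{N}^{\mathbb{T}}$. A system (resp. environment) transition is $\tau:L\times L\to\mathbb{N}\times\{0\}\times\mathbb{N}$ (resp. $\{0\}\times\mathbb{N}\times\mathbb{N}$) with $\tau(\ell,\ell')\ne(0,0,0)$ only if $\ell'=\ell+w$ for some $w\in A_s^*$ (resp. $A_e^*$). With $\mathrm{out}_\tau(\ell)=\sum_{\ell'}\tau(\ell,\ell')$, $\mathrm{in}_\tau(\ell)=\sum_{\ell'}\tau(\ell',\ell)$, $\tau$ is applicable at $C$ if $\mathrm{out}_\tau\le C$ componentwise, and $\tau(C)=C-\mathrm{out}_\tau+\mathrm{in}_\tau$. $C\models\mathcal{F}$ if some $\kappa\in\mathcal{F}$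 has $C(\ell)$ satisfying $\kappa(\ell)$ componentwise for all $\ell$. A $C$-play $C_0\tau_1C_1\dots\tau_nC_n$ has $C_0=C$, $C_i=\tau_i(C_{i-1})$, odd $i$: system transition and $C_i\models\mathcal{F}$; even $i$: environment transition and $C_i\not\models\mathcal{F}$. A $C$-strategy is a partial map $f$ from $C$-plays to system transitions, defined on $C$, returning only transitions applicable at the last configuration and leading to a configuration satisfying $\mathcal{F}$. Plays are $f$-compatible if odd moves follow $f$, $f$-maximal if not a strict prefix of an $f$-compatible play, winning if the last configuration satisfies $\mathcal{F}$; $f$ is winning if all $f$-compatible $f$-maximal $C$-plays are winning. $C_{\vec k}$ maps $\ell_0$ to $\vec k$ and other locations to $(0,0,0)$; $\mathrm{Win}(\mathcal{G})=\{\vec k\in\mathbb{N}^{\mathbb{T}}\mid C_{\vec k}$ is winning for System$\}$. For $W\subseteq\mathbb{N}^{\mathbb{T}}$ and $N_s,N_e,N_{se}\subseteq\mathbb{N}$, $\vec k_0$ is a cutoff of $W$ with respect to $(N_s,N_e,N_{se})$ if $\vec k_0\in N_s\times N_e\times N_{se}$ and either all $\vec k\in N_s\times N_e\times N_{se}$ with $\vec k\ge\vec k_0$ (componentwise) lie in $W$, or all such $\vec k$ lie outside $W$. -}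

module Defs where

open import Data.Nat using (ℕ; zero; suc; _+_; _∸_; _≤_)
open import Data.Bool using (Bool; true; false)
open import Data.Fin using (Fin; zero; suc)
import Data.Fin.Properties as FinP
open import Data.Vec using (Vec; []; _∷_; replicate; _[_]%=_)
import Data.Vec.Properties as VecP
open import Data.List using (List; []; _∷_; [_]; _++_; map; concatMap; allFin)
open import Data.Nat.ListAction using (sum)
open import Data.Unit using (⊤)
open import Data.List.Relation.Unary.All using (All)
open import Data.List.Relation.Unary.Any using (Any)
open import Data.Maybe using (Maybe; just; nothing)
open import Data.Product using (Σ; ∃; _×_; _,_)
open import Data.Sum using (_⊎_)
open import Data.Empty using (⊥)
open import Relation.Nullary using (¬_; yes; no)
open import Relation.Binary.PropositionalEquality using (_≡_; _≢_)

data 𝕋 : Set where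
  s e se : 𝕋

ℕ^𝕋 : Set
ℕ^𝕋 = 𝕋 → ℕ

_≤𝕋_ : ℕ^𝕋 → ℕ^𝕋 → Set
u ≤𝕋 v = ∀ θ → u θ ≤ v θ

-- Local acceptance conditions ℭ : (⋈_s n_s, ⋈_e n_e, ⋈_se n_se), ⋈ ∈ {=, ≥}

data Cmp : Set where
  eq geq : Cmp

LAC : Set
LAC = 𝕋 → Cmp × ℕ

satC : Cmp × ℕ → ℕ → Set
satC (eq  , n) m = m ≡ n
satC (geq , n) m = n ≤ m

satLAC : LAC → ℕ^𝕋 → Set
satLAC κ v = ∀ θ → satC (κ θ) (v θ)

-- Saturating increment on {0,…,B} : i ↦ min (i+1) B

incSat : ∀ {B} → Fin (suc B) → Fin (suc B)
incSat {zero}  zero    = zero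
incSat {suc B} zero    = suc zero
incSat {suc B} (suc i) = suc (incSat {B} i)

allVecs : ∀ n m → List (Vec (Fin m) n)
allVecs zero    m = [ [] ]
allVecs (suc n) m = concatMap (λ i → map (i ∷_) (allVecs n m)) (allFin m)

-- A = Fin nA, with A_s = {a | sys a ≡ true}, A_e = {a | sys a ≡ false}.
-- Locations L = {0,…,B}^A are represented as Vec (Fin (suc B)) nA.

record Game : Set where
  field
    nA  : ℕ
    sys : Fin nA → Bool
    B   : ℕ
    𝓕   : List (Vec (Fin (suc B)) nA → LAC)

module _ (G : Game) where
  open Game G

  Loc : Set
  Loc = Vec (Fin (suc B)) nA

  allLocs : List Loc
  allLocs = allVecs nA (suc B)

  ℓ₀ : Loc
  ℓ₀ = replicate nA zero

  _+ₐ_ : Loc → Fin nA → Loc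
  ℓ +ₐ a = ℓ [ a ]%= incSat

  _+ʷ_ : Loc → List (Fin nA) → Loc
  ℓ +ʷ []      = ℓ
  ℓ +ʷ (a ∷ w) = (ℓ +ₐ a) +ʷ w

  ReachBy : Bool → Loc → Loc → Set
  ReachBy b ℓ ℓ' = Σ (List (Fin nA)) λ w → All (λ a → sys a ≡ b) w × (ℓ +ʷ w ≡ ℓ')

  Config : Set
  Config = Loc → ℕ^𝕋

  Trans : Set
  Trans = Loc → Loc → ℕ^𝕋

  IsZero : ℕ^𝕋 → Set
  IsZero v = ∀ θ → v θ ≡ 0

  IsSysTrans : Trans → Set
  IsSysTrans τ = ∀ ℓ ℓ' → (τ ℓ ℓ' e ≡ 0) × (¬ IsZero (τ ℓ ℓ') → ReachBy true ℓ ℓ')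

  IsEnvTrans : Trans → Set
  IsEnvTrans τ = ∀ ℓ ℓ' → (τ ℓ ℓ' s ≡ 0) × (¬ IsZero (τ ℓ ℓ') → ReachBy false ℓ ℓ')

  out : Trans → Loc → ℕ^𝕋
  out τ ℓ θ = sum (map (λ ℓ' → τ ℓ ℓ' θ) allLocs)

  inn : Trans → Loc → ℕ^𝕋
  inn τ ℓ θ = sum (map (λ ℓ' → τ ℓ' ℓ θ) allLocs)

  Applicable : Trans → Config → Set
  Applicable τ C = ∀ ℓ → out τ ℓ ≤𝕋 C ℓ

  -- τ(C) = C - out_τ + in_τ   (subtraction is exact when τ is applicable)
  apply : Trans → Config → Config
  apply τ C ℓ θ = (C ℓ θ ∸ out τ ℓ θ) + inn τ ℓ θ

  _⊨𝓕 : Config → Set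
  C ⊨𝓕 = Any (λ κ → ∀ ℓ → satLAC (κ ℓ) (C ℓ)) 𝓕

  lastConf : Config → List Trans → Config
  lastConf C []       = C
  lastConf C (τ ∷ ts) = lastConf (apply τ C) ts

  ValidFrom : Bool → Config → List Trans → Set
  ValidFrom _     C []       = ⊤
  ValidFrom true  C (τ ∷ ts) =
    IsSysTrans τ × Applicable τ C × (apply τ C ⊨𝓕) × ValidFrom false (apply τ C) ts
  ValidFrom false C (τ ∷ ts) =
    IsEnvTrans τ × Applicable τ C × (¬ (apply τ C ⊨𝓕)) × ValidFrom true (apply τ C) ts

  -- C-plays C₀ τ₁ C₁ … τₙ Cₙ with C₀ = C, represented by their transition list
  IsPlay : Config → List Trans → Set
  IsPlay C ts = ValidFrom true C ts

  PreStrategy : Set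
  PreStrategy = List Trans → Maybe Trans

  IsStrategy : Config → PreStrategy → Set
  IsStrategy C f =
    (f [] ≢ nothing) ×
    (∀ ts τ → IsPlay C ts → f ts ≡ just τ →
       IsSysTrans τ × Applicable τ (lastConf C ts) × (apply τ (lastConf C ts) ⊨𝓕))

  CompatFrom : PreStrategy → List Trans → Bool → List Trans → Set
  CompatFrom f pre _     []       = ⊤
  CompatFrom f pre true  (τ ∷ ts) = (f pre ≡ just τ) × CompatFrom f (pre ++ [ τ ]) false ts
  CompatFrom f pre false (τ ∷ ts) = CompatFrom f (pre ++ [ τ ]) true ts

  Compatible : Config → PreStrategy → List Trans → Set
  Compatible C f ts = IsPlay C ts × CompatFrom f [] true ts

  Maximal : Config → PreStrategy → List Trans → Set
  Maximal C f ts = ∀ τ us → ¬ Compatible C f (ts ++ (τ ∷ us))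

  IsWinningStrategy : Config → PreStrategy → Set
  IsWinningStrategy C f =
    IsStrategy C f × (∀ ts → Compatible C f ts → Maximal C f ts → lastConf C ts ⊨𝓕)

  WinningConfig : Config → Set
  WinningConfig C = Σ PreStrategy (IsWinningStrategy C)

  initConf : ℕ^𝕋 → Config
  initConf k ℓ with VecP.≡-dec FinP._≟_ ℓ ℓ₀
  ... | yes _ = k
  ... | no  _ = λ _ → 0

  Win : ℕ^𝕋 → Set
  Win k = WinningConfig (initConf k)

Cutoff : (ℕ^𝕋 → Set) → (ℕ → Set) → (ℕ → Set) → (ℕ → Set) → ℕ^𝕋 → Set
Cutoff W Ns Ne Nse k₀ =
  (Ns (k₀ s) × Ne (k₀ e) × Nse (k₀ se)) ×
  ( (∀ k → Ns (k s) → Ne (k e) → Nse (k se) → k₀ ≤𝕋 k → W k)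
  ⊎ (∀ k → Ns (k s) → Ne (k e) → Nse (k se) → k₀ ≤𝕋 k → ¬ W k))

-- All agents are se-agents and start in the pool L₀₀. System transitions move mass only
-- forward along rows and Environment transitions only forward along columns, and the
-- acceptance conditions constrain the seven inner locations so tightly that a finite
-- check shows every legal move to be the intended one: System first draws one agent from
-- the pool, and then in each round Environment and System each draw one more agent while
-- the agents drawn earlier travel on into the sink L₂₂. A player who must draw from an
-- empty pool cannot move; if that is Environment, the last configuration satisfies 𝓕 and
-- System has won, if it is System, it does not. Hence System wins exactly when the number
-- of agents is odd.
module Submission where

open import Defs
open import Data.Nat using (ℕ; zero; suc; _+_; _*_; _∸_; _≤_; _<_; z≤n; s≤s)
open import Data.Nat.Properties
open import Data.Bool using (Bool; true; false; not; _xor_; if_then_else_)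
open import Data.Bool.Properties as Bool using (not-involutive)
open import Data.Fin using (Fin; zero; suc)
import Data.Fin as Fin
import Data.Fin.Properties as Fin
open import Data.Vec as Vec using (Vec; lookup)
open import Data.Vec.Properties using (≡-dec)
open import Data.Vec.Relation.Binary.Pointwise.Inductive as Pointwise using (Pointwise)
open import Data.List using (List; []; _∷_; [_]; _++_; map; length; upTo; cartesianProductWith)
open import Data.List.Properties using (map-cong; ++-assoc; ++-identityʳ)
open import Data.Nat.ListAction using (sum)
open import Data.List.Relation.Unary.All as All using (All; all?)
open import Data.List.Relation.Unary.Any as Any using (here; there)
open import Data.List.Relation.Unary.Any.Properties using (map⁺; map⁻)
open import Data.List.Membership.Propositional using (_∈_)
open import Data.List.Membership.Propositional.Properties using (∈-cartesianProductWith⁺; ∈-upTo⁺)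
open import Data.Maybe using (Maybe; just; nothing)
open import Data.Product using (Σ; ∃; _×_; _,_; proj₁; proj₂)
open import Data.Sum using (_⊎_; inj₁; inj₂)
open import Data.Unit using (⊤; tt)
open import Data.Empty using (⊥; ⊥-elim)
open import Function using (_∘_)
open import Relation.Nullary using (¬_; Dec; yes; no; does; ¬?)
import Relation.Nullary.Decidable as Dec
open import Relation.Nullary.Decidable using (_×-dec_; _⊎-dec_; _→-dec_; from-yes)
open import Relation.Binary.PropositionalEquality
  using (_≡_; refl; sym; trans; cong; cong₂; subst; subst₂; module ≡-Reasoning)
open import Data.Nat.Tactic.RingSolver using (solve)

ForwardShift : (r₀ r₁ r₂ c₀ c₁ c₂ : ℕ) → Set
ForwardShift r₀ r₁ r₂ c₀ c₁ c₂ = r₀ ≤ c₀ × r₀ + r₁ ≤ c₀ + c₁ × r₀ + (r₁ + r₂) ≡ c₀ + (c₁ + c₂)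

forwardShift? : ∀ r₀ r₁ r₂ c₀ c₁ c₂ → Dec (ForwardShift r₀ r₁ r₂ c₀ c₁ c₂)
forwardShift? r₀ r₁ r₂ c₀ c₁ c₂ =
  r₀ ≤? c₀ ×-dec r₀ + r₁ ≤? c₀ + c₁ ×-dec r₀ + (r₁ + r₂) ≟ c₀ + (c₁ + c₂)

forwardShift-suffix : ∀ {r₀ r₁ r₂ c₀ c₁ c₂} → ForwardShift r₀ r₁ r₂ c₀ c₁ c₂ →
  c₂ ≤ r₂ × c₁ + c₂ ≤ r₁ + r₂
forwardShift-suffix {r₀} {r₁} {r₂} {c₀} {c₁} {c₂} (r₀≤ , r₀₁≤ , total) =
    +-cancelˡ-≤ (c₀ + c₁) c₂ r₂ (begin
      c₀ + c₁ + c₂   ≡⟨ +-assoc c₀ c₁ c₂ ⟩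
      c₀ + (c₁ + c₂) ≡⟨ total ⟨
      r₀ + (r₁ + r₂) ≡⟨ +-assoc r₀ r₁ r₂ ⟨
      r₀ + r₁ + r₂   ≤⟨ +-monoˡ-≤ r₂ r₀₁≤ ⟩
      c₀ + c₁ + r₂   ∎)
  , +-cancelˡ-≤ c₀ (c₁ + c₂) (r₁ + r₂) (begin
      c₀ + (c₁ + c₂) ≡⟨ total ⟨
      r₀ + (r₁ + r₂) ≤⟨ +-monoˡ-≤ (r₁ + r₂) r₀≤ ⟩
      c₀ + (r₁ + r₂) ∎)
  where open ≤-Reasoning

-- The hypotheses are the balance equations of three cells in a line along which mass
-- only moves forward, aᵢⱼ being the flow from cell i to cell j, in the normal form
-- that out and inn compute to.
forwardShift-by-flows : ∀ {r₀ r₁ r₂ c₀ c₁ c₂} a₀₀ a₀₁ a₀₂ a₁₁ a₁₂ a₂₂ →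
  r₀ + (a₀₀ + (a₀₁ + (a₀₂ + 0))) ≡ c₀ + (a₀₀ + 0) →
  r₁ + (a₁₁ + (a₁₂ + 0)) ≡ c₁ + (a₀₁ + (a₁₁ + 0)) →
  r₂ + (a₂₂ + 0) ≡ c₂ + (a₀₂ + (a₁₂ + (a₂₂ + 0))) →
  ForwardShift r₀ r₁ r₂ c₀ c₁ c₂
forwardShift-by-flows {r₀} {r₁} {r₂} {c₀} {c₁} {c₂} a₀₀ a₀₁ a₀₂ a₁₁ a₁₂ a₂₂ cell₀ cell₁ cell₂ =
  subst (r₀ ≤_) E₀ (m≤m+n r₀ (a₀₁ + a₀₂)) , subst (r₀ + r₁ ≤_) E₀₁ (m≤m+n (r₀ + r₁) (a₀₂ + a₁₂)) , total
  where
  open ≡-Reasoning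
  E₀ : r₀ + (a₀₁ + a₀₂) ≡ c₀
  E₀ = +-cancelˡ-≡ a₀₀ _ _ (begin
    a₀₀ + (r₀ + (a₀₁ + a₀₂))       ≡⟨ solve (a₀₀ ∷ r₀ ∷ a₀₁ ∷ a₀₂ ∷ []) ⟩
    r₀ + (a₀₀ + (a₀₁ + (a₀₂ + 0))) ≡⟨ cell₀ ⟩
    c₀ + (a₀₀ + 0)                 ≡⟨ solve (a₀₀ ∷ c₀ ∷ []) ⟩
    a₀₀ + c₀                       ∎)
  E₁ : r₁ + a₁₂ ≡ c₁ + a₀₁
  E₁ = +-cancelˡ-≡ a₁₁ _ _ (begin
    a₁₁ + (r₁ + a₁₂)               ≡⟨ solve (a₁₁ ∷ r₁ ∷ a₁₂ ∷ []) ⟩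
    r₁ + (a₁₁ + (a₁₂ + 0))         ≡⟨ cell₁ ⟩
    c₁ + (a₀₁ + (a₁₁ + 0))         ≡⟨ solve (a₁₁ ∷ c₁ ∷ a₀₁ ∷ []) ⟩
    a₁₁ + (c₁ + a₀₁)               ∎)
  E₂ : r₂ ≡ c₂ + (a₀₂ + a₁₂)
  E₂ = +-cancelˡ-≡ a₂₂ _ _ (begin
    a₂₂ + r₂                       ≡⟨ solve (a₂₂ ∷ r₂ ∷ []) ⟩
    r₂ + (a₂₂ + 0)                 ≡⟨ cell₂ ⟩
    c₂ + (a₀₂ + (a₁₂ + (a₂₂ + 0))) ≡⟨ solve (a₂₂ ∷ c₂ ∷ a₀₂ ∷ a₁₂ ∷ []) ⟩
    a₂₂ + (c₂ + (a₀₂ + a₁₂))       ∎)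
  E₀₁ : r₀ + r₁ + (a₀₂ + a₁₂) ≡ c₀ + c₁
  E₀₁ = +-cancelʳ-≡ a₀₁ _ _ (begin
    r₀ + r₁ + (a₀₂ + a₁₂) + a₀₁    ≡⟨ solve (r₀ ∷ r₁ ∷ a₀₂ ∷ a₁₂ ∷ a₀₁ ∷ []) ⟩
    r₀ + (a₀₁ + a₀₂) + (r₁ + a₁₂)  ≡⟨ cong₂ _+_ E₀ E₁ ⟩
    c₀ + (c₁ + a₀₁)                ≡⟨ +-assoc c₀ c₁ a₀₁ ⟨
    c₀ + c₁ + a₀₁                  ∎)
  total : r₀ + (r₁ + r₂) ≡ c₀ + (c₁ + c₂)
  total = begin
    r₀ + (r₁ + r₂)                 ≡⟨ cong (λ x → r₀ + (r₁ + x)) E₂ ⟩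
    r₀ + (r₁ + (c₂ + (a₀₂ + a₁₂))) ≡⟨ solve (r₀ ∷ r₁ ∷ c₂ ∷ a₀₂ ∷ a₁₂ ∷ []) ⟩
    r₀ + r₁ + (a₀₂ + a₁₂) + c₂     ≡⟨ cong (_+ c₂) E₀₁ ⟩
    c₀ + c₁ + c₂                   ≡⟨ +-assoc c₀ c₁ c₂ ⟩
    c₀ + (c₁ + c₂)                 ∎

flips : ℕ → Bool → Bool
flips zero    b = b
flips (suc n) b = flips n (not b)

flips-snoc : ∀ {A : Set} (xs : List A) x b → flips (length (xs ++ [ x ])) b ≡ not (flips (length xs) b)
flips-snoc []       x b = refl
flips-snoc (_ ∷ xs) x b = flips-snoc xs x (not b)

incSat-inflationary : ∀ {B} (i : Fin (suc B)) → i Fin.≤ incSat i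
incSat-inflationary {zero}  zero    = z≤n
incSat-inflationary {suc B} zero    = z≤n
incSat-inflationary {suc B} (suc i) = s≤s (incSat-inflationary i)

balance : ∀ (𝒢 : Game) τ C → Applicable 𝒢 τ C → ∀ ℓ θ →
  apply 𝒢 τ C ℓ θ + out 𝒢 τ ℓ θ ≡ C ℓ θ + inn 𝒢 τ ℓ θ
balance 𝒢 τ C app ℓ θ = begin
  (c ∸ o) + i + o   ≡⟨ +-assoc (c ∸ o) i o ⟩
  (c ∸ o) + (i + o) ≡⟨ cong ((c ∸ o) +_) (+-comm i o) ⟩
  (c ∸ o) + (o + i) ≡⟨ +-assoc (c ∸ o) o i ⟨
  (c ∸ o) + o + i   ≡⟨ cong (_+ i) (m∸n+n≡m (app ℓ θ)) ⟩
  c + i             ∎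
  where
  open ≡-Reasoning
  c = C ℓ θ
  o = out 𝒢 τ ℓ θ
  i = inn 𝒢 τ ℓ θ

module _ (𝒢 : Game) where

  Outcome : Bool → Config 𝒢 → Set
  Outcome true  C = _⊨𝓕 𝒢 C
  Outcome false C = ¬ _⊨𝓕 𝒢 C

  MoveKind : Bool → Trans 𝒢 → Set
  MoveKind true  = IsSysTrans 𝒢
  MoveKind false = IsEnvTrans 𝒢

  LegalMove : Bool → Trans 𝒢 → Config 𝒢 → Set
  LegalMove b τ C = MoveKind b τ × Applicable 𝒢 τ C × Outcome b (apply 𝒢 τ C)

  mover : List (Trans 𝒢) → Bool
  mover ts = flips (length ts) true

  validFrom-∷⁻ : ∀ b {C τ ts} → ValidFrom 𝒢 b C (τ ∷ ts) →
    LegalMove b τ C × ValidFrom 𝒢 (not b) (apply 𝒢 τ C) ts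
  validFrom-∷⁻ true  (kind , app , outcome , valid) = (kind , app , outcome) , valid
  validFrom-∷⁻ false (kind , app , outcome , valid) = (kind , app , outcome) , valid

  validFrom-snoc : ∀ b C ts {τ} → ValidFrom 𝒢 b C ts →
    LegalMove (flips (length ts) b) τ (lastConf 𝒢 C ts) → ValidFrom 𝒢 b C (ts ++ [ τ ])
  validFrom-snoc true  C []       _ (kind , app , outcome) = kind , app , outcome , tt
  validFrom-snoc false C []       _ (kind , app , outcome) = kind , app , outcome , tt
  validFrom-snoc true  C (σ ∷ ts) (kind , app , outcome , valid) legal =
    kind , app , outcome , validFrom-snoc false (apply 𝒢 σ C) ts valid legal
  validFrom-snoc false C (σ ∷ ts) (kind , app , outcome , valid) legal =
    kind , app , outcome , validFrom-snoc true (apply 𝒢 σ C) ts valid legal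

  compatFrom-++ : ∀ f pre b ts us → CompatFrom 𝒢 f pre b ts →
    CompatFrom 𝒢 f (pre ++ ts) (flips (length ts) b) us → CompatFrom 𝒢 f pre b (ts ++ us)
  compatFrom-++ f pre b [] us _ rest = subst (λ pre → CompatFrom 𝒢 f pre b us) (++-identityʳ pre) rest
  compatFrom-++ f pre true (τ ∷ ts) us (chosen , compat) rest =
    chosen , compatFrom-++ f (pre ++ [ τ ]) false ts us compat
      (subst (λ pre → CompatFrom 𝒢 f pre _ us) (sym (++-assoc pre [ τ ] ts)) rest)
  compatFrom-++ f pre false (τ ∷ ts) us compat rest =
    compatFrom-++ f (pre ++ [ τ ]) true ts us compat
      (subst (λ pre → CompatFrom 𝒢 f pre _ us) (sym (++-assoc pre [ τ ] ts)) rest)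

  compatFrom-split : ∀ f pre b ts us → CompatFrom 𝒢 f pre b (ts ++ us) →
    CompatFrom 𝒢 f (pre ++ ts) (flips (length ts) b) us
  compatFrom-split f pre b [] us compat = subst (λ pre → CompatFrom 𝒢 f pre b us) (sym (++-identityʳ pre)) compat
  compatFrom-split f pre true (τ ∷ ts) us (_ , compat) =
    subst (λ pre → CompatFrom 𝒢 f pre _ us) (++-assoc pre [ τ ] ts)
      (compatFrom-split f (pre ++ [ τ ]) false ts us compat)
  compatFrom-split f pre false (τ ∷ ts) us compat =
    subst (λ pre → CompatFrom 𝒢 f pre _ us) (++-assoc pre [ τ ] ts)
      (compatFrom-split f (pre ++ [ τ ]) true ts us compat)

  lastConf-snoc : ∀ C ts τ → lastConf 𝒢 C (ts ++ [ τ ]) ≡ apply 𝒢 τ (lastConf 𝒢 C ts)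
  lastConf-snoc C []       τ = refl
  lastConf-snoc C (σ ∷ ts) τ = lastConf-snoc (apply 𝒢 σ C) ts τ

  compatible-snoc : ∀ {C f ts τ} → Compatible 𝒢 C f ts →
    LegalMove (mover ts) τ (lastConf 𝒢 C ts) → CompatFrom 𝒢 f ts (mover ts) [ τ ] →
    Compatible 𝒢 C f (ts ++ [ τ ])
  compatible-snoc {C} {f} {ts} (play , compat) legal follows =
    validFrom-snoc true C ts play legal , compatFrom-++ f [] true ts [ _ ] compat follows

-- Lᵢⱼ is the location reached by i System steps and j Environment steps; all agents
-- start in the pool L₀₀, and L₂₂ is a sink.
Location : Set
Location = Vec (Fin 3) 2

pattern f0 = zero
pattern f1 = suc zero
pattern f2 = suc (suc zero)

pattern loc i j = i Vec.∷ j Vec.∷ Vec.[]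

pattern L00 = loc f0 f0
pattern L01 = loc f0 f1
pattern L02 = loc f0 f2
pattern L10 = loc f1 f0
pattern L11 = loc f1 f1
pattern L12 = loc f1 f2
pattern L20 = loc f2 f0
pattern L21 = loc f2 f1
pattern L22 = loc f2 f2

_≟ₗ_ : (ℓ ℓ' : Location) → Dec (ℓ ≡ ℓ')
_≟ₗ_ = ≡-dec Fin._≟_

byLocation : {P : Location → Set} →
  P L00 → P L01 → P L02 → P L10 → P L11 → P L12 → P L20 → P L21 → P L22 → ∀ ℓ → P ℓ
byLocation p00 _ _ _ _ _ _ _ _ L00 = p00
byLocation _ p01 _ _ _ _ _ _ _ L01 = p01
byLocation _ _ p02 _ _ _ _ _ _ L02 = p02
byLocation _ _ _ p10 _ _ _ _ _ L10 = p10
byLocation _ _ _ _ p11 _ _ _ _ L11 = p11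
byLocation _ _ _ _ _ p12 _ _ _ L12 = p12
byLocation _ _ _ _ _ _ p20 _ _ L20 = p20
byLocation _ _ _ _ _ _ _ p21 _ L21 = p21
byLocation _ _ _ _ _ _ _ _ p22 L22 = p22

-- The counts at the seven locations other than pool and sink, in the order
-- L₀₁, L₀₂, L₁₀, L₁₁, L₁₂, L₂₀, L₂₁.
Shape : Set
Shape = Vec ℕ 7

pattern shape n₁ n₂ n₃ n₄ n₅ n₆ n₇ =
  n₁ Vec.∷ n₂ Vec.∷ n₃ Vec.∷ n₄ Vec.∷ n₅ Vec.∷ n₆ Vec.∷ n₇ Vec.∷ Vec.[]

x01 x02 x10 x11 x12 x20 x21 : Shape → ℕ
x01 (shape n _ _ _ _ _ _) = n
x02 (shape _ n _ _ _ _ _) = n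
x10 (shape _ _ n _ _ _ _) = n
x11 (shape _ _ _ n _ _ _) = n
x12 (shape _ _ _ _ n _ _) = n
x20 (shape _ _ _ _ _ n _) = n
x21 (shape _ _ _ _ _ _ n) = n

anything : Cmp × ℕ
anything = geq , 0

onSE : (Location → Cmp × ℕ) → Location → LAC
onSE κ ℓ s  = anything
onSE κ ℓ e  = anything
onSE κ ℓ se = κ ℓ

crowdedAt : Location → Location → Cmp × ℕ
crowdedAt a ℓ = if does (ℓ ≟ₗ a) then (geq , 2) else anything

exactly : Shape → Location → Cmp × ℕ
exactly t L00 = anything
exactly t L01 = eq , x01 t
exactly t L02 = eq , x02 t
exactly t L10 = eq , x10 t
exactly t L11 = eq , x11 t
exactly t L12 = eq , x12 t
exactly t L20 = eq , x20 t
exactly t L21 = eq , x21 t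
exactly t L22 = anything

-- Exactly the uncrowded shapes that Environment could produce from one of its phases
-- other than the intended one, so that accepting them rules out every deviation of
-- Environment; they include the shapes System produces in the intended play.
exactShapes : List Shape
exactShapes =
    shape 0 0 0 0 1 0 0 ∷ shape 0 0 0 0 2 0 0 ∷ shape 0 0 0 0 2 0 1 ∷ shape 0 0 0 1 0 0 0
  ∷ shape 0 0 0 1 0 0 1 ∷ shape 0 0 0 1 1 0 0 ∷ shape 0 0 0 1 1 0 1 ∷ shape 0 0 1 0 0 0 0
  ∷ shape 0 0 1 0 1 0 1 ∷ shape 0 1 0 0 0 0 0 ∷ shape 0 1 0 0 0 0 1 ∷ shape 0 1 0 0 0 1 0
  ∷ shape 0 1 0 0 1 0 0 ∷ shape 0 1 0 0 1 0 1 ∷ shape 0 1 0 0 2 0 0 ∷ shape 0 1 0 0 2 0 1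
  ∷ shape 0 1 0 1 0 0 0 ∷ shape 0 1 0 1 0 0 1 ∷ shape 0 1 0 1 1 0 0 ∷ shape 0 1 0 1 1 0 1
  ∷ shape 0 1 1 0 0 0 0 ∷ shape 0 1 1 0 1 0 0 ∷ shape 0 1 1 0 1 0 1 ∷ shape 1 0 0 0 0 0 0
  ∷ shape 1 0 0 0 0 1 0 ∷ shape 1 0 0 0 1 0 0 ∷ shape 1 0 0 0 1 0 1 ∷ shape 1 0 0 0 2 0 0
  ∷ shape 1 0 0 0 2 0 1 ∷ shape 1 0 0 1 0 0 0 ∷ shape 1 0 0 1 0 0 1 ∷ shape 1 0 0 1 1 0 0
  ∷ shape 1 0 0 1 1 0 1 ∷ shape 1 0 1 0 1 0 0 ∷ shape 1 0 1 0 1 0 1 ∷ shape 1 1 0 0 0 0 0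
  ∷ shape 1 1 0 0 0 0 1 ∷ shape 1 1 0 0 0 1 0 ∷ shape 1 1 0 0 1 0 0 ∷ shape 1 1 0 0 1 0 1
  ∷ shape 1 1 0 0 2 0 0 ∷ shape 1 1 0 0 2 0 1 ∷ shape 1 1 0 1 0 0 0 ∷ shape 1 1 0 1 0 0 1
  ∷ shape 1 1 0 1 1 0 0 ∷ shape 1 1 0 1 1 0 1 ∷ shape 1 1 1 0 0 0 0 ∷ shape 1 1 1 0 1 0 0
  ∷ shape 1 1 1 0 1 0 1 ∷ []

isSystemAction : Fin 2 → Bool
isSystemAction f0 = true
isSystemAction f1 = false

G : Game
G = record
  { nA  = 2
  ; sys = isSystemAction
  ; B   = 2
  ; 𝓕   = onSE (crowdedAt L01) ∷ onSE (crowdedAt L02) ∷ map (onSE ∘ exactly) exactShapes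
  }

profile : Shape → ℕ → ℕ → Location → ℕ
profile t pool sink L00 = pool
profile t pool sink L01 = x01 t
profile t pool sink L02 = x02 t
profile t pool sink L10 = x10 t
profile t pool sink L11 = x11 t
profile t pool sink L12 = x12 t
profile t pool sink L20 = x20 t
profile t pool sink L21 = x21 t
profile t pool sink L22 = sink

record Shaped (C : Config G) (t : Shape) (pool sink : ℕ) : Set where
  constructor shaped
  field at : ∀ ℓ → C ℓ se ≡ profile t pool sink ℓ

shapeOf : Config G → Shape
shapeOf C = shape (C L01 se) (C L02 se) (C L10 se) (C L11 se) (C L12 se) (C L20 se) (C L21 se)

shape-≡ : ∀ {m₁ m₂ m₃ m₄ m₅ m₆ m₇ n₁ n₂ n₃ n₄ n₅ n₆ n₇ : ℕ} →
  m₁ ≡ n₁ → m₂ ≡ n₂ → m₃ ≡ n₃ → m₄ ≡ n₄ → m₅ ≡ n₅ → m₆ ≡ n₆ → m₇ ≡ n₇ →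
  _≡_ {A = Shape} (shape m₁ m₂ m₃ m₄ m₅ m₆ m₇) (shape n₁ n₂ n₃ n₄ n₅ n₆ n₇)
shape-≡ refl refl refl refl refl refl refl = refl

shapeOf-shaped : ∀ {C t pool sink} → Shaped C t pool sink → shapeOf C ≡ t
shapeOf-shaped {t = shape _ _ _ _ _ _ _} (shaped h) =
  shape-≡ (h L01) (h L02) (h L10) (h L11) (h L12) (h L20) (h L21)

shaped-shapeOf : ∀ {C t pool sink} → shapeOf C ≡ t → C L00 se ≡ pool → C L22 se ≡ sink →
  Shaped C t pool sink
shaped-shapeOf refl p z = shaped (byLocation p refl refl refl refl refl refl refl z)

Crowded : Shape → Set
Crowded t = 2 ≤ x01 t ⊎ 2 ≤ x02 t

Accepted : Shape → Set
Accepted t = Crowded t ⊎ t ∈ exactShapes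

_≟ₛ_ : (t u : Shape) → Dec (t ≡ u)
_≟ₛ_ = ≡-dec _≟_

open import Data.List.Membership.DecPropositional _≟ₛ_ using (_∈?_)

accepted? : ∀ t → Dec (Accepted t)
accepted? t = (2 ≤? x01 t ⊎-dec 2 ≤? x02 t) ⊎-dec t ∈? exactShapes

onSE-sat : ∀ {κ} (C : Config G) → (∀ ℓ → satC (κ ℓ) (C ℓ se)) → ∀ ℓ → satLAC (onSE κ ℓ) (C ℓ)
onSE-sat C h ℓ s  = z≤n
onSE-sat C h ℓ e  = z≤n
onSE-sat C h ℓ se = h ℓ

crowdedAt-sat : ∀ {a} (C : Config G) → 2 ≤ C a se → ∀ ℓ → satC (crowdedAt a ℓ) (C ℓ se)
crowdedAt-sat {a} C h ℓ with ℓ ≟ₗ a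
... | yes refl = h
... | no  _    = z≤n

exactly-sat : ∀ (C : Config G) ℓ → satC (exactly (shapeOf C) ℓ) (C ℓ se)
exactly-sat C = byLocation z≤n refl refl refl refl refl refl refl z≤n

exactly-sat⁻ : ∀ {C t} → (∀ ℓ → satC (exactly t ℓ) (C ℓ se)) → shapeOf C ≡ t
exactly-sat⁻ {t = shape _ _ _ _ _ _ _} h =
  shape-≡ (h L01) (h L02) (h L10) (h L11) (h L12) (h L20) (h L21)

⊨𝓕⇒accepted : ∀ C → _⊨𝓕 G C → Accepted (shapeOf C)
⊨𝓕⇒accepted C (here h)         = inj₁ (inj₁ (h L01 se))
⊨𝓕⇒accepted C (there (here h)) = inj₁ (inj₂ (h L02 se))
⊨𝓕⇒accepted C (there (there h)) =
  inj₂ (Any.map (λ h → exactly-sat⁻ {C} (λ ℓ → h ℓ se)) (map⁻ {f = onSE ∘ exactly} {xs = exactShapes} h))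

accepted⇒⊨𝓕 : ∀ C → Accepted (shapeOf C) → _⊨𝓕 G C
accepted⇒⊨𝓕 C (inj₁ (inj₁ h)) = here (onSE-sat C (crowdedAt-sat C h))
accepted⇒⊨𝓕 C (inj₁ (inj₂ h)) = there (here (onSE-sat C (crowdedAt-sat C h)))
accepted⇒⊨𝓕 C (inj₂ t∈)       =
  there (there (map⁺ {f = onSE ∘ exactly} {xs = exactShapes} (Any.map (λ { refl → onSE-sat C (exactly-sat C) }) t∈)))

Uncrowded : Shape → Set
Uncrowded t = x01 t ≤ 1 × x02 t ≤ 1

Along : Bool → Location → Location → Set
Along true  ℓ ℓ' = lookup ℓ f1 ≡ lookup ℓ' f1 × lookup ℓ f0 Fin.≤ lookup ℓ' f0
Along false ℓ ℓ' = lookup ℓ f0 ≡ lookup ℓ' f0 × lookup ℓ f1 Fin.≤ lookup ℓ' f1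

along? : ∀ b ℓ ℓ' → Dec (Along b ℓ ℓ')
along? true  ℓ ℓ' = lookup ℓ f1 Fin.≟ lookup ℓ' f1 ×-dec lookup ℓ f0 Fin.≤? lookup ℓ' f0
along? false ℓ ℓ' = lookup ℓ f0 Fin.≟ lookup ℓ' f0 ×-dec lookup ℓ f1 Fin.≤? lookup ℓ' f1

+ʷ-along : ∀ b (i j : Fin 3) w → All (λ a → isSystemAction a ≡ b) w →
  Along b (loc i j) (_+ʷ_ G (loc i j) w)
+ʷ-along true  i j []       All.[]    = refl , Fin.≤-refl
+ʷ-along false i j []       All.[]    = refl , Fin.≤-refl
+ʷ-along true  i j (f0 ∷ w) (_ All.∷ ws) =
  let j≡j' , i'≤ = +ʷ-along true (incSat i) j w ws in j≡j' , Fin.≤-trans (incSat-inflationary i) i'≤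
+ʷ-along true  i j (f1 ∷ w) (() All.∷ _)
+ʷ-along false i j (f0 ∷ w) (() All.∷ _)
+ʷ-along false i j (f1 ∷ w) (_ All.∷ ws) =
  let i≡i' , j'≤ = +ʷ-along false i (incSat j) w ws in i≡i' , Fin.≤-trans (incSat-inflationary j) j'≤

reach⇒along : ∀ {b ℓ ℓ'} → ReachBy G b ℓ ℓ' → Along b ℓ ℓ'
reach⇒along {ℓ = loc i j} (w , ws , refl) = +ʷ-along _ i j w ws

Supported : Bool → Trans G → Set
Supported b τ = ∀ ℓ ℓ' → ¬ IsZero G (τ ℓ ℓ') → ReachBy G b ℓ ℓ'

supported-off-along : ∀ {b τ} → Supported b τ → ∀ ℓ ℓ' → ¬ Along b ℓ ℓ' → τ ℓ ℓ' se ≡ 0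
supported-off-along {τ = τ} sup ℓ ℓ' ¬along with τ ℓ ℓ' se in τℓℓ'≡
... | zero  = refl
... | suc _ = ⊥-elim (¬along (reach⇒along (sup ℓ ℓ' λ isZero → 0≢1+n (trans (sym (isZero se)) τℓℓ'≡))))

keepIf : ∀ {P : Set} → Dec P → ℕ → ℕ
keepIf (yes _) n = n
keepIf (no  _) n = 0

out-along : ∀ {b τ} → Supported b τ → ∀ ℓ →
  out G τ ℓ se ≡ sum (map (λ ℓ' → keepIf (along? b ℓ ℓ') (τ ℓ ℓ' se)) (allLocs G))
out-along {b} {τ} sup ℓ = cong sum (map-cong kept (allLocs G))
  where
  kept : ∀ ℓ' → τ ℓ ℓ' se ≡ keepIf (along? b ℓ ℓ') (τ ℓ ℓ' se)
  kept ℓ' with along? b ℓ ℓ'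
  ... | yes _      = refl
  ... | no ¬along = supported-off-along sup ℓ ℓ' ¬along

inn-along : ∀ {b τ} → Supported b τ → ∀ ℓ →
  inn G τ ℓ se ≡ sum (map (λ ℓ' → keepIf (along? b ℓ' ℓ) (τ ℓ' ℓ se)) (allLocs G))
inn-along {b} {τ} sup ℓ = cong sum (map-cong kept (allLocs G))
  where
  kept : ∀ ℓ' → τ ℓ' ℓ se ≡ keepIf (along? b ℓ' ℓ) (τ ℓ' ℓ se)
  kept ℓ' with along? b ℓ' ℓ
  ... | yes _      = refl
  ... | no ¬along = supported-off-along sup ℓ' ℓ ¬along

CellBalance : Bool → Trans G → Config G → Location → Set
CellBalance b τ C ℓ =
  apply G τ C ℓ se + sum (map (λ ℓ' → keepIf (along? b ℓ ℓ') (τ ℓ ℓ' se)) (allLocs G))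
    ≡ C ℓ se + sum (map (λ ℓ' → keepIf (along? b ℓ' ℓ) (τ ℓ' ℓ se)) (allLocs G))

balance-along : ∀ {b τ} C → Supported b τ → Applicable G τ C → ∀ ℓ → CellBalance b τ C ℓ
balance-along {τ = τ} C sup app ℓ =
  subst₂ (λ o i → apply G τ C ℓ se + o ≡ C ℓ se + i) (out-along sup ℓ) (inn-along sup ℓ)
    (balance G τ C app ℓ se)

LineShift : Config G → Config G → Location → Location → Location → Set
LineShift C' C ℓ₀ ℓ₁ ℓ₂ = ForwardShift (C' ℓ₀ se) (C' ℓ₁ se) (C' ℓ₂ se) (C ℓ₀ se) (C ℓ₁ se) (C ℓ₂ se)

rows-shift : ∀ {τ} C → Supported true τ → Applicable G τ C → let C' = apply G τ C in
  LineShift C' C L00 L10 L20 × LineShift C' C L01 L11 L21 × LineShift C' C L02 L12 L22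
rows-shift {τ} C sup app =
    forwardShift-by-flows (t L00 L00) (t L00 L10) (t L00 L20) (t L10 L10) (t L10 L20) (t L20 L20)
      (cell L00) (cell L10) (cell L20)
  , forwardShift-by-flows (t L01 L01) (t L01 L11) (t L01 L21) (t L11 L11) (t L11 L21) (t L21 L21)
      (cell L01) (cell L11) (cell L21)
  , forwardShift-by-flows (t L02 L02) (t L02 L12) (t L02 L22) (t L12 L12) (t L12 L22) (t L22 L22)
      (cell L02) (cell L12) (cell L22)
  where
  t : Location → Location → ℕ
  t ℓ ℓ' = τ ℓ ℓ' se
  cell : ∀ ℓ → CellBalance true τ C ℓ
  cell = balance-along C sup app

columns-shift : ∀ {τ} C → Supported false τ → Applicable G τ C → let C' = apply G τ C in
  LineShift C' C L00 L01 L02 × LineShift C' C L10 L11 L12 × LineShift C' C L20 L21 L22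
columns-shift {τ} C sup app =
    forwardShift-by-flows (t L00 L00) (t L00 L01) (t L00 L02) (t L01 L01) (t L01 L02) (t L02 L02)
      (cell L00) (cell L01) (cell L02)
  , forwardShift-by-flows (t L10 L10) (t L10 L11) (t L10 L12) (t L11 L11) (t L11 L12) (t L12 L12)
      (cell L10) (cell L11) (cell L12)
  , forwardShift-by-flows (t L20 L20) (t L20 L21) (t L20 L22) (t L21 L21) (t L21 L22) (t L22 L22)
      (cell L20) (cell L21) (cell L22)
  where
  t : Location → Location → ℕ
  t ℓ ℓ' = τ ℓ ℓ' se
  cell : ∀ ℓ → CellBalance false τ C ℓ
  cell = balance-along C sup app

lineShift-shaped : ∀ C' {C t pool sink} → Shaped C t pool sink → ∀ {ℓ₀ ℓ₁ ℓ₂} → LineShift C' C ℓ₀ ℓ₁ ℓ₂ →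
  ForwardShift (C' ℓ₀ se) (C' ℓ₁ se) (C' ℓ₂ se)
    (profile t pool sink ℓ₀) (profile t pool sink ℓ₁) (profile t pool sink ℓ₂)
lineShift-shaped C' (shaped at) {ℓ₀} {ℓ₁} {ℓ₂} shift
  rewrite at ℓ₀ | at ℓ₁ | at ℓ₂ = shift

-- Row 0 contains the pool and row 2 the sink, whose counts are not part of a shape:
-- only the suffix, resp. prefix, inequalities of a forward shift survive.
SysSuccessor : Shape → Shape → Set
SysSuccessor c u =
  ForwardShift (x01 u) (x11 u) (x21 u) (x01 c) (x11 c) (x21 c) ×
  (x02 u ≤ x02 c × x02 u + x12 u ≤ x02 c + x12 c) ×
  (x20 c ≤ x20 u × x10 c + x20 c ≤ x10 u + x20 u)

EnvSuccessor : Shape → Shape → Set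
EnvSuccessor c u =
  (x02 c ≤ x02 u × x01 c + x02 c ≤ x01 u + x02 u) ×
  ForwardShift (x10 u) (x11 u) (x12 u) (x10 c) (x11 c) (x12 c) ×
  (x20 u ≤ x20 c × x20 u + x21 u ≤ x20 c + x21 c)

sysSuccessor? : ∀ c u → Dec (SysSuccessor c u)
sysSuccessor? c u =
  forwardShift? (x01 u) (x11 u) (x21 u) (x01 c) (x11 c) (x21 c) ×-dec
  (x02 u ≤? x02 c ×-dec x02 u + x12 u ≤? x02 c + x12 c) ×-dec
  (x20 c ≤? x20 u ×-dec x10 c + x20 c ≤? x10 u + x20 u)

envSuccessor? : ∀ c u → Dec (EnvSuccessor c u)
envSuccessor? c u =
  (x02 c ≤? x02 u ×-dec x01 c + x02 c ≤? x01 u + x02 u) ×-dec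
  forwardShift? (x10 u) (x11 u) (x12 u) (x10 c) (x11 c) (x12 c) ×-dec
  (x20 u ≤? x20 c ×-dec x20 u + x21 u ≤? x20 c + x21 c)

box : ∀ {n} → Vec ℕ n → List (Vec ℕ n)
box Vec.[]       = [ Vec.[] ]
box (b Vec.∷ bs) = cartesianProductWith Vec._∷_ (upTo (suc b)) (box bs)

∈-box : ∀ {n} {u b : Vec ℕ n} → Pointwise _≤_ u b → u ∈ box b
∈-box Pointwise.[]            = here refl
∈-box (u≤b Pointwise.∷ us≤bs) =
  ∈-cartesianProductWith⁺ Vec._∷_ (∈-upTo⁺ (s≤s u≤b)) (∈-box us≤bs)

envBound : Shape → Shape
envBound c = shape 1 1 (x10 c) (x10 c + x11 c) (x10 c + (x11 c + x12 c)) (x20 c) (x20 c + x21 c)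

envSuccessor-bounded : ∀ {c u} → EnvSuccessor c u → Uncrowded u → Pointwise _≤_ u (envBound c)
envSuccessor-bounded {c} {u = shape u₁ u₂ u₃ u₄ u₅ u₆ u₇}
  (_ , (u₃≤ , u₃₄≤ , total) , (u₆≤ , u₆₇≤)) (u₁≤1 , u₂≤1) =
  u₁≤1 Pointwise.∷ u₂≤1 Pointwise.∷ u₃≤ Pointwise.∷ m+n≤o⇒n≤o u₃ u₃₄≤ Pointwise.∷
  ≤-trans (m≤n+m u₅ (u₃ + u₄)) (≤-reflexive (trans (+-assoc u₃ u₄ u₅) total)) Pointwise.∷
  u₆≤ Pointwise.∷ m+n≤o⇒n≤o u₆ u₆₇≤ Pointwise.∷ Pointwise.[]

Forced : Bool → Shape → Shape → Set
Forced true  c Y = All (λ u → SysSuccessor c u → u ≡ Y) exactShapes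
Forced false c Y = All (λ u → EnvSuccessor c u → u ∈ exactShapes ⊎ u ≡ Y) (box (envBound c))

forced? : ∀ b c Y → Dec (Forced b c Y)
forced? true  c Y = all? (λ u → sysSuccessor? c u →-dec u ≟ₛ Y) exactShapes
forced? false c Y = all? (λ u → envSuccessor? c u →-dec (u ∈? exactShapes ⊎-dec u ≟ₛ Y)) (box (envBound c))

poolMass sinkMass : Bool → Shape → ℕ
poolMass true  t = x10 t + x20 t
poolMass false t = x01 t + x02 t
sinkMass true  t = x02 t + x12 t
sinkMass false t = x20 t + x21 t

record AfterMove (b : Bool) (C' : Config G) (c Y : Shape) (pool sink : ℕ) : Set where
  field
    shape≡    : shapeOf C' ≡ Y
    pool-line : C' L00 se + poolMass b (shapeOf C') ≡ pool + poolMass b c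
    sink-line : sinkMass b (shapeOf C') + C' L22 se ≡ sinkMass b c + sink

total-reassoc : ∀ a b c a' b' c' → a + (b + c) ≡ a' + (b' + c') → a + b + c ≡ a' + b' + c'
total-reassoc a b c a' b' c' total = trans (+-assoc a b c) (trans total (sym (+-assoc a' b' c')))

sys-forced : ∀ {τ C c Y pool sink} → Forced true c Y → Uncrowded c → Shaped C c pool sink →
  LegalMove G true τ C → AfterMove true (apply G τ C) c Y pool sink
sys-forced {τ} {C} {c} {Y} {pool} {sink} forced (c₀₁≤1 , c₀₂≤1) sh (sys , app , accepted) = record
  { shape≡    = shape≡
  ; pool-line = proj₂ (proj₂ row₀)
  ; sink-line = total-reassoc (r L02 se) (r L12 se) (r L22 se) (x02 c) (x12 c) sink (proj₂ (proj₂ row₂))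
  }
  where
  r : Config G
  r = apply G τ C
  rows : LineShift r C L00 L10 L20 × LineShift r C L01 L11 L21 × LineShift r C L02 L12 L22
  rows = rows-shift C (λ ℓ ℓ' → proj₂ (sys ℓ ℓ')) app
  row₀ : ForwardShift (r L00 se) (r L10 se) (r L20 se) pool (x10 c) (x20 c)
  row₀ = lineShift-shaped r sh (proj₁ rows)
  row₁ : ForwardShift (r L01 se) (r L11 se) (r L21 se) (x01 c) (x11 c) (x21 c)
  row₁ = lineShift-shaped r sh (proj₁ (proj₂ rows))
  row₂ : ForwardShift (r L02 se) (r L12 se) (r L22 se) (x02 c) (x12 c) sink
  row₂ = lineShift-shaped r sh (proj₂ (proj₂ rows))
  successor : SysSuccessor c (shapeOf r)
  successor = row₁ , (proj₁ row₂ , proj₁ (proj₂ row₂)) , forwardShift-suffix row₀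
  shape≡ : shapeOf r ≡ Y
  shape≡ with ⊨𝓕⇒accepted r accepted
  ... | inj₁ (inj₁ 2≤r₀₁) = ⊥-elim (1+n≰n (≤-trans 2≤r₀₁ (≤-trans (proj₁ row₁) c₀₁≤1)))
  ... | inj₁ (inj₂ 2≤r₀₂) = ⊥-elim (1+n≰n (≤-trans 2≤r₀₂ (≤-trans (proj₁ row₂) c₀₂≤1)))
  ... | inj₂ r∈           = All.lookup forced r∈ successor

env-forced : ∀ {τ C c Y pool sink} → Forced false c Y → Shaped C c pool sink →
  LegalMove G false τ C → AfterMove false (apply G τ C) c Y pool sink
env-forced {τ} {C} {c} {Y} {pool} {sink} forced sh (env , app , rejected) = record
  { shape≡    = shape≡
  ; pool-line = proj₂ (proj₂ col₀)
  ; sink-line = total-reassoc (r L20 se) (r L21 se) (r L22 se) (x20 c) (x21 c) sink (proj₂ (proj₂ col₂))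
  }
  where
  r : Config G
  r = apply G τ C
  cols : LineShift r C L00 L01 L02 × LineShift r C L10 L11 L12 × LineShift r C L20 L21 L22
  cols = columns-shift C (λ ℓ ℓ' → proj₂ (env ℓ ℓ')) app
  col₀ : ForwardShift (r L00 se) (r L01 se) (r L02 se) pool (x01 c) (x02 c)
  col₀ = lineShift-shaped r sh (proj₁ cols)
  col₁ : ForwardShift (r L10 se) (r L11 se) (r L12 se) (x10 c) (x11 c) (x12 c)
  col₁ = lineShift-shaped r sh (proj₁ (proj₂ cols))
  col₂ : ForwardShift (r L20 se) (r L21 se) (r L22 se) (x20 c) (x21 c) sink
  col₂ = lineShift-shaped r sh (proj₂ (proj₂ cols))
  uncrowded : Uncrowded (shapeOf r)
  uncrowded = ≤-pred (≰⇒> λ crowded → rejected (accepted⇒⊨𝓕 r (inj₁ (inj₁ crowded))))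
            , ≤-pred (≰⇒> λ crowded → rejected (accepted⇒⊨𝓕 r (inj₁ (inj₂ crowded))))
  successor : EnvSuccessor c (shapeOf r)
  successor = forwardShift-suffix col₀ , col₁ , (proj₁ col₂ , proj₁ (proj₂ col₂))
  shape≡ : shapeOf r ≡ Y
  shape≡ with All.lookup forced (∈-box (envSuccessor-bounded {c} successor uncrowded)) successor
  ... | inj₁ r∈   = ⊥-elim (rejected (accepted⇒⊨𝓕 r (inj₂ r∈)))
  ... | inj₂ r≡Y = r≡Y

drawn : ∀ {n d m m' p} → n + m' ≡ p + m → m' ≡ d + m → d ≤ p × n ≡ p ∸ d
drawn {n} {d} {m} {m'} {p} line m'≡ = subst (d ≤_) n+d≡p (m≤n+m d n) , sym (trans (cong (_∸ d) (sym n+d≡p)) (m+n∸n≡m n d))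
  where
  n+d≡p : n + d ≡ p
  n+d≡p = +-cancelʳ-≡ m _ _ (begin
    n + d + m   ≡⟨ +-assoc n d m ⟩
    n + (d + m) ≡⟨ cong (n +_) m'≡ ⟨
    n + m'      ≡⟨ line ⟩
    p + m       ∎)
    where open ≡-Reasoning

deposited : ∀ {n d m m' z} → m' + n ≡ m + z → m ≡ m' + d → n ≡ d + z
deposited {n} {d} {m} {m'} {z} line m≡ = +-cancelˡ-≡ m' _ _ (begin
  m' + n       ≡⟨ line ⟩
  m + z        ≡⟨ cong (_+ z) m≡ ⟩
  m' + d + z   ≡⟨ +-assoc m' d z ⟩
  m' + (d + z) ∎)
  where open ≡-Reasoning

settle : ∀ {b C' c Y pool sink d d'} → AfterMove b C' c Y pool sink →
  poolMass b Y ≡ d + poolMass b c → sinkMass b c ≡ sinkMass b Y + d' →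
  d ≤ pool × Shaped C' Y (pool ∸ d) (d' + sink)
settle record { shape≡ = refl ; pool-line = pool-line ; sink-line = sink-line } poolΔ sinkΔ =
  let d≤pool , pool≡ = drawn pool-line poolΔ in
  d≤pool , shaped-shapeOf refl pool≡ (deposited sink-line sinkΔ)

keepIf-nonzero : ∀ {P : Set} {n} (d : Dec P) → ¬ keepIf d n ≡ 0 → P
keepIf-nonzero (yes p) _       = p
keepIf-nonzero (no _)  nonzero = ⊥-elim (nonzero refl)

unitMove : Location → Location → Trans G
unitMove a a' ℓ ℓ' s  = 0
unitMove a a' ℓ ℓ' e  = 0
unitMove a a' ℓ ℓ' se = keepIf (ℓ ≟ₗ a ×-dec ℓ' ≟ₗ a') 1

unitMove-supported : ∀ {b a a'} → ReachBy G b a a' → Supported b (unitMove a a')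
unitMove-supported {a = a} {a'} reach ℓ ℓ' nonzero
  with refl , refl ← keepIf-nonzero (ℓ ≟ₗ a ×-dec ℓ' ≟ₗ a')
                       (λ moved≡0 → nonzero λ { s → refl ; e → refl ; se → moved≡0 })
  = reach

unitMove-kind : ∀ b {a a'} → ReachBy G b a a' → MoveKind G b (unitMove a a')
unitMove-kind true  reach ℓ ℓ' = refl , unitMove-supported reach ℓ ℓ'
unitMove-kind false reach ℓ ℓ' = refl , unitMove-supported reach ℓ ℓ'

unitMove-effect : ∀ {a a' C t pool sink t' pool' sink'} → Shaped C t pool sink →
  (∀ ℓ → out G (unitMove a a') ℓ se ≤ profile t pool sink ℓ) →
  (∀ ℓ → profile t pool sink ℓ ∸ out G (unitMove a a') ℓ se + inn G (unitMove a a') ℓ se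
           ≡ profile t' pool' sink' ℓ) →
  Applicable G (unitMove a a') C × Shaped (apply G (unitMove a a') C) t' pool' sink'
unitMove-effect {a} {a'} (shaped at) out≤ effect =
    (λ { ℓ s → z≤n ; ℓ e → z≤n ; ℓ se → subst (out G (unitMove a a') ℓ se ≤_) (sym (at ℓ)) (out≤ ℓ) })
  , shaped λ ℓ → trans (cong (λ n → n ∸ out G (unitMove a a') ℓ se + inn G (unitMove a a') ℓ se) (at ℓ)) (effect ℓ)

actionOf : Bool → Fin 2
actionOf true  = f0
actionOf false = f1

step-reach : ∀ b ℓ → ReachBy G b ℓ (_+ₐ_ G ℓ (actionOf b))
step-reach true  ℓ = [ f0 ] , refl All.∷ All.[] , refl
step-reach false ℓ = [ f1 ] , refl All.∷ All.[] , refl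

data Phase : Set where
  P0 P1 P2 P3 P4 P5 P6 P7 P8 : Phase

sysTurn : Phase → Bool
sysTurn P0 = true
sysTurn P1 = false
sysTurn P2 = true
sysTurn P3 = false
sysTurn P4 = true
sysTurn P5 = false
sysTurn P6 = true
sysTurn P7 = false
sysTurn P8 = true

next : Phase → Phase
next P0 = P1
next P1 = P2
next P2 = P3
next P3 = P4
next P4 = P5
next P5 = P6
next P6 = P7
next P7 = P8
next P8 = P1

phaseShape : Phase → Shape
phaseShape P0 = shape 0 0 0 0 0 0 0
phaseShape P1 = shape 0 0 1 0 0 0 0
phaseShape P2 = shape 1 0 1 0 0 0 0
phaseShape P3 = shape 1 0 0 0 0 1 0
phaseShape P4 = shape 1 0 0 0 0 0 1
phaseShape P5 = shape 0 0 0 1 0 0 1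
phaseShape P6 = shape 0 0 0 0 1 0 1
phaseShape P7 = shape 0 0 1 0 1 0 1
phaseShape P8 = shape 0 0 1 0 1 0 0

source : Phase → Location
source P0 = L00
source P1 = L00
source P2 = L10
source P3 = L20
source P4 = L01
source P5 = L11
source P6 = L00
source P7 = L21
source P8 = L12

draws deposits : Phase → ℕ
draws P0 = 1
draws P1 = 1
draws P6 = 1
draws _  = 0
deposits P7 = 1
deposits P8 = 1
deposits _  = 0

intended : Phase → Trans G
intended ph = unitMove (source ph) (_+ₐ_ G (source ph) (actionOf (sysTurn ph)))

intended-kind : ∀ ph → MoveKind G (sysTurn ph) (intended ph)
intended-kind ph = unitMove-kind (sysTurn ph) (step-reach (sysTurn ph) (source ph))

intended-effect : ∀ ph {C pool sink} → draws ph ≤ pool → Shaped C (phaseShape ph) pool sink →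
  Applicable G (intended ph) C ×
  Shaped (apply G (intended ph) C) (phaseShape (next ph)) (pool ∸ draws ph) (deposits ph + sink)
intended-effect P0 {sink = z} d≤p sh = unitMove-effect sh
  (byLocation d≤p z≤n z≤n z≤n z≤n z≤n z≤n z≤n z≤n)
  (byLocation (+-identityʳ _) refl refl refl refl refl refl refl (+-comm z _))
intended-effect P1 {sink = z} d≤p sh = unitMove-effect sh
  (byLocation d≤p z≤n z≤n z≤n z≤n z≤n z≤n z≤n z≤n)
  (byLocation (+-identityʳ _) refl refl refl refl refl refl refl (+-comm z _))
intended-effect P2 {sink = z} d≤p sh = unitMove-effect sh
  (byLocation z≤n z≤n z≤n (s≤s z≤n) z≤n z≤n z≤n z≤n z≤n)
  (byLocation (+-identityʳ _) refl refl refl refl refl refl refl (+-comm z _))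
intended-effect P3 {sink = z} d≤p sh = unitMove-effect sh
  (byLocation z≤n z≤n z≤n z≤n z≤n z≤n (s≤s z≤n) z≤n z≤n)
  (byLocation (+-identityʳ _) refl refl refl refl refl refl refl (+-comm z _))
intended-effect P4 {sink = z} d≤p sh = unitMove-effect sh
  (byLocation z≤n (s≤s z≤n) z≤n z≤n z≤n z≤n z≤n z≤n z≤n)
  (byLocation (+-identityʳ _) refl refl refl refl refl refl refl (+-comm z _))
intended-effect P5 {sink = z} d≤p sh = unitMove-effect sh
  (byLocation z≤n z≤n z≤n z≤n (s≤s z≤n) z≤n z≤n z≤n z≤n)
  (byLocation (+-identityʳ _) refl refl refl refl refl refl refl (+-comm z _))
intended-effect P6 {sink = z} d≤p sh = unitMove-effect sh
  (byLocation d≤p z≤n z≤n z≤n z≤n z≤n z≤n z≤n z≤n)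
  (byLocation (+-identityʳ _) refl refl refl refl refl refl refl (+-comm z _))
intended-effect P7 {sink = z} d≤p sh = unitMove-effect sh
  (byLocation z≤n z≤n z≤n z≤n z≤n z≤n z≤n (s≤s z≤n) z≤n)
  (byLocation (+-identityʳ _) refl refl refl refl refl refl refl (+-comm z _))
intended-effect P8 {sink = z} d≤p sh = unitMove-effect sh
  (byLocation z≤n z≤n z≤n z≤n z≤n (s≤s z≤n) z≤n z≤n z≤n)
  (byLocation (+-identityʳ _) refl refl refl refl refl refl refl (+-comm z _))

-- A configuration in which b is to move was produced by the opponent.
LegalArrival : Bool → Shape → Set
LegalArrival true  t = ¬ Accepted t
LegalArrival false t = Accepted t

legalArrival? : ∀ b t → Dec (LegalArrival b t)
legalArrival? true  t = ¬? (accepted? t)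
legalArrival? false t = accepted? t

record PhaseLaws (b : Bool) (ph : Phase) : Set where
  field
    forced      : Forced b (phaseShape ph) (phaseShape (next ph))
    uncrowded   : Uncrowded (phaseShape ph)
    arrival     : LegalArrival b (phaseShape ph)
    pool-drawn  : poolMass b (phaseShape (next ph)) ≡ draws ph + poolMass b (phaseShape ph)
    sink-filled : sinkMass b (phaseShape ph) ≡ sinkMass b (phaseShape (next ph)) + deposits ph
    alternates  : sysTurn (next ph) ≡ not b

phaseLaws? : ∀ b ph → Dec (PhaseLaws b ph)
phaseLaws? b ph = Dec.map′ (λ (f , u , a , p , k , t) → record
    { forced = f ; uncrowded = u ; arrival = a ; pool-drawn = p ; sink-filled = k ; alternates = t })
  (λ l → let open PhaseLaws l in forced , uncrowded , arrival , pool-drawn , sink-filled , alternates)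
  (forced? b c Y ×-dec (x01 c ≤? 1 ×-dec x02 c ≤? 1) ×-dec legalArrival? b c ×-dec
   poolMass b Y ≟ draws ph + poolMass b c ×-dec sinkMass b c ≟ sinkMass b Y + deposits ph ×-dec
   sysTurn (next ph) Bool.≟ not b)
  where
  c Y : Shape
  c = phaseShape ph
  Y = phaseShape (next ph)

phaseLaws : ∀ ph → PhaseLaws (sysTurn ph) ph
phaseLaws P0 = from-yes (phaseLaws? true  P0)
phaseLaws P1 = from-yes (phaseLaws? false P1)
phaseLaws P2 = from-yes (phaseLaws? true  P2)
phaseLaws P3 = from-yes (phaseLaws? false P3)
phaseLaws P4 = from-yes (phaseLaws? true  P4)
phaseLaws P5 = from-yes (phaseLaws? false P5)
phaseLaws P6 = from-yes (phaseLaws? true  P6)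
phaseLaws P7 = from-yes (phaseLaws? false P7)
phaseLaws P8 = from-yes (phaseLaws? true  P8)

forced-step : ∀ ph {τ C pool sink} → Shaped C (phaseShape ph) pool sink → LegalMove G (sysTurn ph) τ C →
  draws ph ≤ pool × Shaped (apply G τ C) (phaseShape (next ph)) (pool ∸ draws ph) (deposits ph + sink)
forced-step ph sh legal with sysTurn ph | phaseLaws ph
... | true  | laws = settle (sys-forced forced uncrowded sh legal) pool-drawn sink-filled
  where open PhaseLaws laws
... | false | laws = settle (env-forced forced sh legal) pool-drawn sink-filled
  where open PhaseLaws laws

outcome-by-arrival : ∀ b {C t pool sink} → Shaped C t pool sink → LegalArrival b t → Outcome G (not b) C
outcome-by-arrival true  {C} sh ¬accepted ⊨ = ¬accepted (subst Accepted (shapeOf-shaped sh) (⊨𝓕⇒accepted C ⊨))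
outcome-by-arrival false {C} sh accepted    = accepted⇒⊨𝓕 C (subst Accepted (sym (shapeOf-shaped sh)) accepted)

arrived : ∀ ph {C pool sink} → Shaped C (phaseShape ph) pool sink → Outcome G (not (sysTurn ph)) C
arrived ph sh = outcome-by-arrival (sysTurn ph) sh (PhaseLaws.arrival (phaseLaws ph))

intended-legal : ∀ ph {C pool sink} → draws ph ≤ pool → Shaped C (phaseShape ph) pool sink →
  LegalMove G (sysTurn ph) (intended ph) C
intended-legal ph {C} d≤p sh =
  let app , sh' = intended-effect ph d≤p sh in
  intended-kind ph , app , subst (λ b → Outcome G b (apply G (intended ph) C)) not-not (arrived (next ph) sh')
  where
  not-not : not (sysTurn (next ph)) ≡ sysTurn ph
  not-not = trans (cong not (PhaseLaws.alternates (phaseLaws ph))) (not-involutive (sysTurn ph))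

even : ℕ → Bool
even zero    = true
even (suc n) = not (even n)

even-double : ∀ n → even (n + n) ≡ true
even-double zero    = refl
even-double (suc n) rewrite +-suc n n = trans (not-involutive (even (n + n))) (even-double n)

-- whether the pool is even in phase ph of the plays that start from an odd pool
evenOnWin : Phase → Bool
evenOnWin P1 = true
evenOnWin P7 = true
evenOnWin P8 = true
evenOnWin _  = false

PoolParity : Bool → Phase → ℕ → Set
PoolParity sysLoses ph pool = even pool ≡ evenOnWin ph xor sysLoses

parity-step : ∀ x ph pool → draws ph ≤ pool → PoolParity x ph pool →
  PoolParity x (next ph) (pool ∸ draws ph)
parity-step x P0 (suc q) _ par = trans (sym (not-involutive (even q))) (cong not par)
parity-step x P1 (suc q) _ par = Bool.not-injective par
parity-step x P6 (suc q) _ par = trans (sym (not-involutive (even q))) (cong not par)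
parity-step x P2 pool    _ par = par
parity-step x P3 pool    _ par = par
parity-step x P4 pool    _ par = par
parity-step x P5 pool    _ par = par
parity-step x P7 pool    _ par = par
parity-step x P8 pool    _ par = par

winner-unstuck : ∀ x ph pool → PoolParity x ph pool → sysTurn ph ≡ not x → draws ph ≤ pool
winner-unstuck x     P0 (suc _) _    _  = s≤s z≤n
winner-unstuck x     P1 (suc _) _    _  = s≤s z≤n
winner-unstuck x     P6 (suc _) _    _  = s≤s z≤n
winner-unstuck x     P0 zero    refl ()
winner-unstuck true  P1 zero    ()   _
winner-unstuck false P1 zero    _    ()
winner-unstuck x     P6 zero    refl ()
winner-unstuck x     P2 pool    _    _  = z≤n
winner-unstuck x     P3 pool    _    _  = z≤n
winner-unstuck x     P4 pool    _    _  = z≤n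
winner-unstuck x     P5 pool    _    _  = z≤n
winner-unstuck x     P7 pool    _    _  = z≤n
winner-unstuck x     P8 pool    _    _  = z≤n

rank : Phase → ℕ
rank P0 = 9
rank P1 = 1
rank P2 = 8
rank P3 = 7
rank P4 = 6
rank P5 = 5
rank P6 = 4
rank P7 = 3
rank P8 = 2

measure : Phase → ℕ → ℕ
measure ph pool = rank ph + pool * 10

measure-step : ∀ ph pool → draws ph ≤ pool → measure (next ph) (pool ∸ draws ph) < measure ph pool
measure-step P0 (suc q) _ = +-monoˡ-≤ (q * 10) (m≤m+n 2 17)
measure-step P1 (suc q) _ = +-monoˡ-≤ (q * 10) (m≤m+n 9 2)
measure-step P6 (suc q) _ = +-monoˡ-≤ (q * 10) (m≤m+n 4 10)
measure-step P2 pool    _ = ≤-refl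
measure-step P3 pool    _ = ≤-refl
measure-step P4 pool    _ = ≤-refl
measure-step P5 pool    _ = ≤-refl
measure-step P7 pool    _ = ≤-refl
measure-step P8 pool    _ = ≤-refl

advance : ℕ → Phase → Phase
advance zero    ph = ph
advance (suc n) ph = advance n (next ph)

sysTurn-advance : ∀ n ph → sysTurn (advance n ph) ≡ flips n (sysTurn ph)
sysTurn-advance zero    ph = refl
sysTurn-advance (suc n) ph = trans (sysTurn-advance n (next ph)) (cong (flips n) (PhaseLaws.alternates (phaseLaws ph)))

follows-phases : ∀ x ph {C pool sink} ts → Shaped C (phaseShape ph) pool sink → PoolParity x ph pool →
  ValidFrom G (sysTurn ph) C ts →
  ∃ λ pool' → ∃ λ sink' → let ph' = advance (length ts) ph in
    Shaped (lastConf G C ts) (phaseShape ph') pool' sink' × PoolParity x ph' pool'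
follows-phases x ph []       sh par _     = _ , _ , sh , par
follows-phases x ph {pool = pool} (τ ∷ ts) sh par valid =
  let legal , rest = validFrom-∷⁻ G (sysTurn ph) valid
      d≤pool , sh' = forced-step ph sh legal
  in follows-phases x (next ph) ts sh' (parity-step x ph pool d≤pool par)
       (subst (λ b → ValidFrom G b _ ts) (sym (PhaseLaws.alternates (phaseLaws ph))) rest)

seAgents : ℕ → ℕ^𝕋
seAgents m s  = 0
seAgents m e  = 0
seAgents m se = m

initial-shaped : ∀ m → Shaped (initConf G (seAgents m)) (phaseShape P0) m 0
initial-shaped m = shaped (byLocation refl refl refl refl refl refl refl refl refl)

intendedChoice : Phase → Maybe (Trans G)
intendedChoice ph = if sysTurn ph then just (intended ph) else nothing

intendedChoice-just : ∀ ph {τ} → intendedChoice ph ≡ just τ → sysTurn ph ≡ true × intended ph ≡ τ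
intendedChoice-just ph chosen with sysTurn ph
intendedChoice-just ph refl | true = refl , refl
intendedChoice-just ph ()   | false

system-wins-odd : ∀ m → even m ≡ false → Win G (seAgents m)
system-wins-odd m odd = strategy , (chooses , wins)
  where
  C₀ : Config G
  C₀ = initConf G (seAgents m)
  phaseAfter : List (Trans G) → Phase
  phaseAfter ts = advance (length ts) P0
  strategy : PreStrategy G
  strategy ts = intendedChoice (phaseAfter ts)
  on-track : ∀ ts → IsPlay G C₀ ts → ∃ λ pool → ∃ λ sink →
    Shaped (lastConf G C₀ ts) (phaseShape (phaseAfter ts)) pool sink × PoolParity false (phaseAfter ts) pool
  on-track ts play = follows-phases false P0 ts (initial-shaped m) odd play
  legal : ∀ ts → IsPlay G C₀ ts → sysTurn (phaseAfter ts) ≡ true →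
    LegalMove G (sysTurn (phaseAfter ts)) (intended (phaseAfter ts)) (lastConf G C₀ ts)
  legal ts play sys-turn =
    let pool , _ , sh , par = on-track ts play in
    intended-legal (phaseAfter ts) (winner-unstuck false (phaseAfter ts) pool par sys-turn) sh
  chooses : IsStrategy G C₀ strategy
  chooses = (λ ()) , λ ts τ play chosen →
    let sys-turn , intended≡ = intendedChoice-just (phaseAfter ts) chosen in
    subst₂ (λ b τ → LegalMove G b τ (lastConf G C₀ ts)) sys-turn intended≡ (legal ts play sys-turn)
  wins : ∀ ts → Compatible G C₀ strategy ts → Maximal G C₀ strategy ts → _⊨𝓕 G (lastConf G C₀ ts)
  wins ts compatible maximal with sysTurn (phaseAfter ts) in turn≡
  ... | false = let _ , _ , sh , _ = on-track ts (proj₁ compatible) in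
                subst (λ b → Outcome G (not b) (lastConf G C₀ ts)) turn≡ (arrived (phaseAfter ts) sh)
  ... | true  = ⊥-elim (maximal τ [] (compatible-snoc G compatible
                  (subst (λ b → LegalMove G b τ (lastConf G C₀ ts)) turn≡mover (legal ts (proj₁ compatible) turn≡))
                  (subst (λ b → CompatFrom G strategy ts b [ τ ]) (trans (sym turn≡) turn≡mover)
                    (cong (λ b → if b then just τ else nothing) turn≡ , tt))))
    where
    τ : Trans G
    τ = intended (phaseAfter ts)
    turn≡mover : sysTurn (phaseAfter ts) ≡ mover G ts
    turn≡mover = sysTurn-advance (length ts) P0

record OnTrack (f : PreStrategy G) (C₀ : Config G) (ts : List (Trans G)) (ph : Phase) (pool sink : ℕ) : Set where
  field
    compatible : Compatible G C₀ f ts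
    in-turn    : sysTurn ph ≡ mover G ts
    at-phase   : Shaped (lastConf G C₀ ts) (phaseShape ph) pool sink
    parity     : PoolParity true ph pool

onTrack-step : ∀ {f C₀ ts ph pool sink τ} → OnTrack f C₀ ts ph pool sink →
  LegalMove G (sysTurn ph) τ (lastConf G C₀ ts) → CompatFrom G f ts (sysTurn ph) [ τ ] →
  draws ph ≤ pool × OnTrack f C₀ (ts ++ [ τ ]) (next ph) (pool ∸ draws ph) (deposits ph + sink)
onTrack-step {f} {C₀} {ts} {ph} {pool} {sink} {τ} track legal follows = d≤pool , record
  { compatible = compatible-snoc G compatible
                   (subst (λ b → LegalMove G b τ (lastConf G C₀ ts)) in-turn legal)
                   (subst (λ b → CompatFrom G f ts b [ τ ]) in-turn follows)
  ; in-turn    = trans (PhaseLaws.alternates (phaseLaws ph)) (trans (cong not in-turn) (sym (flips-snoc ts τ true)))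
  ; at-phase   = subst (λ C → Shaped C (phaseShape (next ph)) (pool ∸ draws ph) (deposits ph + sink))
                   (sym (lastConf-snoc G C₀ ts τ)) (proj₂ step)
  ; parity     = parity-step true ph pool d≤pool parity
  }
  where
  open OnTrack track
  step : draws ph ≤ pool ×
    Shaped (apply G τ (lastConf G C₀ ts)) (phaseShape (next ph)) (pool ∸ draws ph) (deposits ph + sink)
  step = forced-step ph at-phase legal
  d≤pool : draws ph ≤ pool
  d≤pool = proj₁ step

system-loses-even : ∀ m → even m ≡ true → ¬ Win G (seAgents m)
system-loses-even m even-m (f , (_ , chooses) , wins) = stall (suc (measure P0 m)) ≤-refl start
  where
  C₀ : Config G
  C₀ = initConf G (seAgents m)
  start : OnTrack f C₀ [] P0 m 0
  start = record { compatible = tt , tt ; in-turn = refl ; at-phase = initial-shaped m ; parity = even-m }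
  continuation : ∀ {ts ph pool sink} → OnTrack f C₀ ts ph pool sink →
    ∃ λ τ → LegalMove G (sysTurn ph) τ (lastConf G C₀ ts) × CompatFrom G f ts (sysTurn ph) [ τ ]
  continuation {ts} {ph} {pool} track with sysTurn ph in turn≡
  ... | false = intended ph
              , subst (λ b → LegalMove G b (intended ph) (lastConf G C₀ ts)) turn≡
                  (intended-legal ph (winner-unstuck true ph pool parity turn≡) at-phase)
              , tt
    where open OnTrack track
  ... | true with f ts in chosen
  ...   | just τ  = τ , chooses ts τ (proj₁ compatible) chosen , refl , tt
    where open OnTrack track
  ...   | nothing = ⊥-elim (subst (λ b → Outcome G (not b) (lastConf G C₀ ts)) turn≡ (arrived ph at-phase)
                              (wins ts compatible maximal))
    where
    open OnTrack track
    maximal : Maximal G C₀ f ts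
    maximal τ us (_ , compat)
      with () ← trans (sym chosen) (proj₁ (subst (λ b → CompatFrom G f ts b (τ ∷ us))
                                             (trans (sym in-turn) turn≡)
                                             (compatFrom-split G f [] true ts (τ ∷ us) compat)))
  stall : ∀ fuel {ts ph pool sink} → measure ph pool < fuel → OnTrack f C₀ ts ph pool sink → ⊥
  stall (suc fuel) {ph = ph} {pool} bound track =
    let τ , legal , follows = continuation track
        d≤pool , track' = onTrack-step track legal follows
    in stall fuel (≤-trans (measure-step ph pool d≤pool) (≤-pred bound)) track'

seAgents-above : ∀ {k₀} m → k₀ s ≡ 0 → k₀ e ≡ 0 → k₀ se ≤ m → k₀ ≤𝕋 seAgents m
seAgents-above m k₀s≡0 _     _     s  = ≤-reflexive k₀s≡0
seAgents-above m _     k₀e≡0 _     e  = ≤-reflexive k₀e≡0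
seAgents-above m _     _     k₀≤m se = k₀≤m

lemma2 : Σ Game λ G → ¬ (∃ λ k₀ → Cutoff (Win G) (_≡ 0) (_≡ 0) (λ _ → ⊤) k₀)
lemma2 = G , λ where
  (k₀ , (k₀s≡0 , k₀e≡0 , _) , inj₁ all-won) →
    let n = k₀ se in
    system-loses-even (n + n) (even-double n)
      (all-won (seAgents (n + n)) refl refl tt (seAgents-above (n + n) k₀s≡0 k₀e≡0 (m≤m+n n n)))
  (k₀ , (k₀s≡0 , k₀e≡0 , _) , inj₂ all-lost) →
    let n = k₀ se in
    all-lost (seAgents (suc (n + n))) refl refl tt
      (seAgents-above (suc (n + n)) k₀s≡0 k₀e≡0 (≤-trans (m≤m+n n n) (n≤1+n (n + n))))
      (system-wins-odd (suc (n + n)) (cong not (even-double n)))
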